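{- The Heawood graph is not 2-tone 6-colorable, i.e., $\tau_2(H)>6$ where $H$ is the Heawood graph.
   Context: The Heawood graph is the point–line incidence graph of the Fano plane (the projective plane of order 2): a 3-regular bipartite graph on 14 vertices (7 points and 7 lines), where a point is adjacent to a line iff it lies on it. A $2$-tone $k$-coloring of a graph $G$ is a function $f:V(G)\to\binom{[k]}{2}$ (assigning to each vertex a 2-element subset of $[k]=\{1,\dots,k\}$) such that $|f(u)\cap f(v)|<d(u,v)$ for all distinct vertices $u,v$, where $d(u,v)$ is the graph distance; equivalently adjacent vertices get disjoint sets and vertices at distance 2 get distinct sets. $\tau_2(G)$ is the minimum $k$ such that $G$ has a 2-tone $k$-coloring. -}

module Defs where

open import Data.Nat using (ℕ; zero; suc; _+_; _∸_; _<_; _<ᵇ_)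
open import Data.Nat.DivMod using (_%_)
open import Data.Bool using (Bool; true; false; _∧_; _∨_; if_then_else_; T)
open import Data.Fin using (Fin; toℕ)
open import Data.Fin.Subset using (Subset; _∩_; ∣_∣)
open import Data.Product using (Σ; _×_)
open import Relation.Binary.PropositionalEquality using (_≡_; _≢_)
open import Relation.Nullary using (¬_)

data Walk {n : ℕ} (adj : Fin n → Fin n → Set) : Fin n → Fin n → ℕ → Set where
  here : ∀ {u} → Walk adj u u zero
  step : ∀ {u w v m} → adj u w → Walk adj w v m → Walk adj u v (suc m)

Dist : ∀ {n} → (Fin n → Fin n → Set) → Fin n → Fin n → ℕ → Set
Dist adj u v d = Walk adj u v d × (∀ m → m < d → ¬ Walk adj u v m)

Is2ToneColoring : ∀ {n} → (Fin n → Fin n → Set) → (k : ℕ) → (Fin n → Subset k) → Set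
Is2ToneColoring {n} adj k f =
  (∀ v → ∣ f v ∣ ≡ 2) ×
  (∀ (u v : Fin n) → u ≢ v → ∀ d → Dist adj u v d → ∣ f u ∩ f v ∣ < d)

Has2ToneColoring : ∀ {n} → (Fin n → Fin n → Set) → ℕ → Set
Has2ToneColoring {n} adj k = Σ (Fin n → Subset k) (Is2ToneColoring adj k)

-- The Heawood graph: incidence graph of the Fano plane.
-- Points are 0..6, lines L_j = {j, j+1, j+3} (mod 7), j = 0..6.
-- Vertex i < 7 is point i; vertex 7 + j is line L_j.

_==_ : ℕ → ℕ → Bool
zero == zero = true
zero == suc _ = false
suc _ == zero = false
suc a == suc b = a == b

incident : ℕ → ℕ → Bool
incident p j = let r = (p + 7 ∸ j) % 7 in (r == 0) ∨ (r == 1) ∨ (r == 3)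

heawoodAdjᵇ : ℕ → ℕ → Bool
heawoodAdjᵇ u v =
  if u <ᵇ 7
  then (if v <ᵇ 7 then false else incident u (v ∸ 7))
  else (if v <ᵇ 7 then incident v (u ∸ 7) else false)

HeawoodAdj : Fin 14 → Fin 14 → Set
HeawoodAdj u v = T (heawoodAdjᵇ (toℕ u) (toℕ v))

module Submission where

-- A 2-tone 6-colouring gives every vertex a 2-subset of the six colours such that adjacent
-- vertices get disjoint sets and vertices at distance 2 share at most one colour.  In the
-- Heawood graph two distinct points, and two distinct lines, of the Fano plane are always at
-- distance 2, so these two conditions are finitely many Boolean constraints on the colours.
--
-- The proof is a verified exhaustive search.  For the Heawood graph we then
-- use the colour symmetry to assume that point 0 is coloured {0,1} and the line L₀ = {0,1,3}
-- (vertex 7) is coloured {2,3}; the search shows this partial colouring does not extend.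

open import Defs
open import Data.Bool using (Bool; true; false; _∧_; not; _xor_; T)
open import Data.Bool.ListAction using (any)
open import Data.Bool.Properties using (T-∧; T-≡; T?) renaming (_≟_ to _≟𝔹_)
open import Data.Fin using (Fin; zero; suc; toℕ; #_)
open import Data.Fin.Permutation using (Permutation; id; transpose; _∘ₚ_; _⟨$⟩ʳ_; _⟨$⟩ˡ_)
open import Data.Fin.Properties using (all?; any?)
open import Data.Fin.Subset using (Subset; _∩_; _∪_; ⁅_⁆; ∣_∣; inside; outside)
open import Data.List using (List; []; _∷_; map; _++_; zip; allFin)
open import Data.List.Membership.Propositional using (_∈_; lose)
open import Data.List.Membership.Propositional.Properties using (∈-map⁺; ∈-++⁺ˡ; ∈-++⁺ʳ)
import Data.List.Relation.Unary.All as All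
open import Data.List.Relation.Unary.All using (All; []; _∷_)
open import Data.List.Relation.Unary.Any using (here)
open import Data.List.Relation.Unary.Any.Properties using (any⁺)
open import Data.Nat using (ℕ; zero; suc; _<_; _<ᵇ_; _≡ᵇ_; s≤s)
open import Data.Nat.Properties using (+-0-commutativeMonoid; <⇒<ᵇ; ≡⇒≡ᵇ; ≡ᵇ⇒≡; n<1⇒n≡0)
  renaming (_≟_ to _≟ℕ_)
open import Algebra.Properties.CommutativeMonoid.Sum +-0-commutativeMonoid using (sum; sum-cong-≗; sum-permute)
open import Data.Product using (Σ; ∃; _×_; _,_)
open import Data.Vec using ([]; _∷_; lookup; tabulate)
open import Data.Vec.Properties using (lookup∘tabulate; tabulate∘lookup; tabulate-cong; lookup-zipWith; ≡-dec)
open import Function using (_∘_; Equivalence)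
open import Relation.Binary.PropositionalEquality
  using (_≡_; _≢_; refl; sym; trans; subst; subst₂; cong; cong₂; module ≡-Reasoning)
open import Relation.Nullary using (¬_)
open import Relation.Nullary.Decidable using (toWitness; _→-dec_; _×-dec_)

walk₀ : ∀ {n} {adj : Fin n → Fin n → Set} {u v} → Walk adj u v 0 → u ≡ v
walk₀ here = refl

walk₁ : ∀ {n} {adj : Fin n → Fin n → Set} {u v} → Walk adj u v 1 → adj u v
walk₁ (step uv here) = uv

dist-adjacent : ∀ {n} {adj : Fin n → Fin n → Set} {u v} → u ≢ v → adj u v → Dist adj u v 1
dist-adjacent u≢v uv = step uv here , λ { zero _ w → u≢v (walk₀ w) ; (suc m) (s≤s ()) _ }

dist-common-neighbour : ∀ {n} {adj : Fin n → Fin n → Set} {u w v} →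
                        u ≢ v → ¬ adj u v → adj u w → adj w v → Dist adj u v 2
dist-common-neighbour {adj = adj} {u} {w} {v} u≢v ¬uv uw wv = step uw (step wv here) , shorter
  where
  shorter : ∀ m → m < 2 → ¬ Walk adj u v m
  shorter zero _ walk = u≢v (walk₀ walk)
  shorter (suc zero) _ walk = ¬uv (walk₁ walk)
  shorter (suc (suc m)) (s≤s (s≤s ())) _

indicator : Bool → ℕ
indicator true = 1
indicator false = 0

∣∣≡sum : ∀ {k} (s : Subset k) → ∣ s ∣ ≡ sum (indicator ∘ lookup s)
∣∣≡sum [] = refl
∣∣≡sum (inside ∷ s) = cong suc (∣∣≡sum s)
∣∣≡sum (outside ∷ s) = ∣∣≡sum s

relabel : ∀ {k} → Permutation k k → Subset k → Subset k
relabel π s = tabulate (λ i → lookup s (π ⟨$⟩ʳ i))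

relabel-size : ∀ {k} (π : Permutation k k) (s : Subset k) → ∣ relabel π s ∣ ≡ ∣ s ∣
relabel-size {k} π s = begin
  ∣ relabel π s ∣                              ≡⟨ ∣∣≡sum (relabel π s) ⟩
  sum (indicator ∘ lookup (relabel π s))       ≡⟨ sum-cong-≗ {k} (cong indicator ∘ lookup∘tabulate _) ⟩
  sum (λ i → indicator (lookup s (π ⟨$⟩ʳ i)))  ≡⟨ sum-permute (indicator ∘ lookup s) π ⟨
  sum (indicator ∘ lookup s)                   ≡⟨ ∣∣≡sum s ⟨
  ∣ s ∣                                        ∎
  where open ≡-Reasoning

relabel-∩ : ∀ {k} (π : Permutation k k) (s t : Subset k) → relabel π (s ∩ t) ≡ relabel π s ∩ relabel π t
relabel-∩ π s t = begin
  relabel π (s ∩ t)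
    ≡⟨ tabulate-cong (λ i → lookup-zipWith _∧_ (π ⟨$⟩ʳ i) s t) ⟩
  tabulate (λ i → lookup s (π ⟨$⟩ʳ i) ∧ lookup t (π ⟨$⟩ʳ i))
    ≡⟨ tabulate-cong (λ i → sym (cong₂ _∧_ (lookup∘tabulate _ i) (lookup∘tabulate _ i))) ⟩
  tabulate (λ i → lookup (relabel π s) i ∧ lookup (relabel π t) i)
    ≡⟨ tabulate-cong (λ i → lookup-zipWith _∧_ i (relabel π s) (relabel π t)) ⟨
  tabulate (lookup (relabel π s ∩ relabel π t))
    ≡⟨ tabulate∘lookup _ ⟩
  relabel π s ∩ relabel π t
    ∎
  where open ≡-Reasoning

relabel-colouring : ∀ {n k} {adj : Fin n → Fin n → Set} {f : Fin n → Subset k} (π : Permutation k k) →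
                    Is2ToneColoring adj k f → Is2ToneColoring adj k (relabel π ∘ f)
relabel-colouring {f = f} π (sizes , separated) =
  (λ v → trans (relabel-size π (f v)) (sizes v)) ,
  (λ u v u≢v d dist → subst (_< d) (shared u v) (separated u v u≢v d dist))
  where
  shared : ∀ u v → ∣ f u ∩ f v ∣ ≡ ∣ relabel π (f u) ∩ relabel π (f v) ∣
  shared u v = begin
    ∣ f u ∩ f v ∣                         ≡⟨ relabel-size π (f u ∩ f v) ⟨
    ∣ relabel π (f u ∩ f v) ∣             ≡⟨ cong ∣_∣ (relabel-∩ π (f u) (f v)) ⟩
    ∣ relabel π (f u) ∩ relabel π (f v) ∣ ∎
    where open ≡-Reasoning

ofSize : (n r : ℕ) → List (Subset n)
ofSize zero zero = [] ∷ []
ofSize zero (suc r) = []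
ofSize (suc n) r = map (outside ∷_) (ofSize n r) ++ containingFirst r
  where
  containingFirst : ℕ → List (Subset (suc n))
  containingFirst zero = []
  containingFirst (suc r) = map (inside ∷_) (ofSize n r)

∈-ofSize : ∀ {n} (s : Subset n) → s ∈ ofSize n ∣ s ∣
∈-ofSize [] = here refl
∈-ofSize (outside ∷ s) = ∈-++⁺ˡ (∈-map⁺ (outside ∷_) (∈-ofSize s))
∈-ofSize (inside ∷ s) = ∈-++⁺ʳ (map (outside ∷_) (ofSize _ (suc ∣ s ∣))) (∈-map⁺ (inside ∷_) (∈-ofSize s))

colour∈ofSize : ∀ {n k} {adj : Fin n → Fin n → Set} {f : Fin n → Subset k} →
                Is2ToneColoring adj k f → ∀ v → f v ∈ ofSize k 2
colour∈ofSize {f = f} (sizes , _) v = subst (λ r → f v ∈ ofSize _ r) (sizes v) (∈-ofSize (f v))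

-- The constraint a 2-tone colouring puts on the colours of two vertices: disjoint colours
-- when adjacent, at most one shared colour (for 2-sets: different colours) at distance 2.
data Requirement : Set where
  disjoint differ free : Requirement

satisfiesᵇ : ∀ {k} → Requirement → Subset k → Subset k → Bool
satisfiesᵇ disjoint s t = ∣ s ∩ t ∣ ≡ᵇ 0
satisfiesᵇ differ s t = ∣ s ∩ t ∣ <ᵇ 2
satisfiesᵇ free _ _ = true

module _ {n k : ℕ} (req : Fin n → Fin n → Requirement) (candidates : List (Subset k)) where

  consistent : List (Fin n × Subset k) → Fin n → Subset k → Bool
  consistent [] v c = true
  consistent ((u , d) ∷ assigned) v c = satisfiesᵇ (req u v) d c ∧ consistent assigned v c

  extendable : List (Fin n × Subset k) → List (Fin n) → Bool
  extendable assigned [] = true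
  extendable assigned (v ∷ vs) =
    any (λ c → consistent assigned v c ∧ extendable ((v , c) ∷ assigned) vs) candidates

  -- The conclusion is an equation
  -- rather than T (…), so that comparing it with a concrete search never forces evaluation.
  module _ (g : Fin n → Subset k) (g-candidate : ∀ v → g v ∈ candidates)
           (g-meets : ∀ u v → T (satisfiesᵇ (req u v) (g u) (g v))) where

    AgreesWith : List (Fin n × Subset k) → Set
    AgreesWith = All (λ { (u , c) → c ≡ g u })

    consistent-sound : ∀ assigned v → AgreesWith assigned → T (consistent assigned v (g v))
    consistent-sound [] v [] = _
    consistent-sound ((u , _) ∷ assigned) v (refl ∷ agrees) =
      Equivalence.from T-∧ (g-meets u v , consistent-sound assigned v agrees)

    extendable-sound : ∀ vs assigned → AgreesWith assigned → extendable assigned vs ≡ true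
    extendable-sound vs assigned agrees = Equivalence.to T-≡ (succeeds vs assigned agrees)
      where
      succeeds : ∀ vs assigned → AgreesWith assigned → T (extendable assigned vs)
      succeeds [] assigned agrees = _
      succeeds (v ∷ vs) assigned agrees =
        any⁺ _ (lose (g-candidate v)
          (Equivalence.from T-∧ (consistent-sound assigned v agrees ,
                                 succeeds vs ((v , g v) ∷ assigned) (refl ∷ agrees))))

onSameSide : Fin 14 → Fin 14 → Bool
onSameSide u v = not ((toℕ u <ᵇ 7) xor (toℕ v <ᵇ 7))

-- Two distinct points lie on a common line and two distinct lines meet in a point:
-- distinct vertices on the same side have a common neighbour (decided for all 14 × 14 pairs).
fano : ∀ u v → T (not (toℕ u ≡ᵇ toℕ v) ∧ onSameSide u v) → ∃ λ w → HeawoodAdj u w × HeawoodAdj w v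
fano = toWitness {a? = all? λ u → all? λ v →
                    T? _ →-dec any? λ w → T? (heawoodAdjᵇ (toℕ u) (toℕ w)) ×-dec T? (heawoodAdjᵇ (toℕ w) (toℕ v))} _

-- Distinct vertices are adjacent (an incident point and line), at distance 2 (same side),
-- or unconstrained (a non-incident point and line, at distance 3).
classify : (equal adjacent sameSide : Bool) → Requirement
classify true _ _ = free
classify false true _ = disjoint
classify false false true = differ
classify false false false = free

requirementᴴ : Fin 14 → Fin 14 → Requirement
requirementᴴ u v = classify (toℕ u ≡ᵇ toℕ v) (heawoodAdjᵇ (toℕ u) (toℕ v)) (onSameSide u v)

heawood-requirements : ∀ {k} {f : Fin 14 → Subset k} → Is2ToneColoring HeawoodAdj k f →
                       ∀ u v → T (satisfiesᵇ (requirementᴴ u v) (f u) (f v))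
heawood-requirements {f = f} (_ , separated) u v = meets _ _ _ refl refl refl
  where
  distinct : (toℕ u ≡ᵇ toℕ v) ≡ false → u ≢ v
  distinct ne refl = subst T ne (≡⇒≡ᵇ (toℕ u) (toℕ u) refl)

  meets : ∀ e a s → (toℕ u ≡ᵇ toℕ v) ≡ e → heawoodAdjᵇ (toℕ u) (toℕ v) ≡ a → onSameSide u v ≡ s →
          T (satisfiesᵇ (classify e a s) (f u) (f v))
  meets true _ _ _ _ _ = _
  meets false true _ ne adj _ =
    ≡⇒≡ᵇ _ 0 (n<1⇒n≡0 (separated u v (distinct ne) 1 (dist-adjacent (distinct ne) (subst T (sym adj) _))))
  meets false false true ne adj side =
    at-distance-two (fano u v (subst₂ (λ e s → T (not e ∧ s)) (sym ne) (sym side) _))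
    where
    at-distance-two : (∃ λ w → HeawoodAdj u w × HeawoodAdj w v) → T (∣ f u ∩ f v ∣ <ᵇ 2)
    at-distance-two (w , uw , wv) =
      <⇒<ᵇ (separated u v (distinct ne) 2 (dist-common-neighbour (distinct ne) (subst T adj) uw wv))
  meets false false false _ _ _ = _

elements : ∀ {k} → Subset k → List (Fin k)
elements [] = []
elements (inside ∷ s) = zero ∷ map suc (elements s)
elements (outside ∷ s) = map suc (elements s)

-- arrange xs sends position i to the i-th entry of xs (when xs has no repetitions): each step
-- composes with a transposition that leaves the positions already placed untouched.
arrange : ∀ {k} → List (Fin k) → Permutation k k
arrange {k} xs = place id (zip (allFin k) xs)
  where
  place : Permutation k k → List (Fin k × Fin k) → Permutation k k
  place π [] = π
  place π ((i , x) ∷ rest) = place (transpose i (π ⟨$⟩ˡ x) ∘ₚ π) rest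

pair : ∀ {k} → Fin k → Fin k → Subset k
pair i j = ⁅ i ⁆ ∪ ⁅ j ⁆

normaliser : Subset 6 → Subset 6 → Permutation 6 6
normaliser s t = arrange (elements s ++ elements t)

Normalises : Subset 6 → Subset 6 → Set
Normalises s t = ∣ s ∩ t ∣ ≡ 0 →
  relabel (normaliser s t) s ≡ pair (# 0) (# 1) × relabel (normaliser s t) t ≡ pair (# 2) (# 3)

normalise : ∀ {s t} → s ∈ ofSize 6 2 → t ∈ ofSize 6 2 → Normalises s t
normalise s∈ t∈ = All.lookup (All.lookup allPairs s∈) t∈
  where
  allPairs : All (λ s → All (Normalises s) (ofSize 6 2)) (ofSize 6 2)
  allPairs = toWitness {a? = All.all? (λ s → All.all? (λ t →
               (∣ s ∩ t ∣ ≟ℕ 0) →-dec (≡-dec _≟𝔹_ _ _ ×-dec ≡-dec _≟𝔹_ _ _)) _) _} _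

NormalisedColouring : Set
NormalisedColouring = Σ (Fin 14 → Subset 6) λ g →
  Is2ToneColoring HeawoodAdj 6 g × g (# 0) ≡ pair (# 0) (# 1) × g (# 7) ≡ pair (# 2) (# 3)

normalised-colouring : ∀ {f : Fin 14 → Subset 6} → Is2ToneColoring HeawoodAdj 6 f → NormalisedColouring
normalised-colouring {f} colouring =
  relabel π ∘ f , relabel-colouring {f = f} π colouring , normalises disjoint₀₇
  where
  π : Permutation 6 6
  π = normaliser (f (# 0)) (f (# 7))

  normalises : Normalises (f (# 0)) (f (# 7))
  normalises = normalise (colour∈ofSize {f = f} colouring (# 0)) (colour∈ofSize {f = f} colouring (# 7))

  disjoint₀₇ : ∣ f (# 0) ∩ f (# 7) ∣ ≡ 0
  disjoint₀₇ = ≡ᵇ⇒≡ _ 0 (heawood-requirements {f = f} colouring (# 0) (# 7))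

searchOrder : List (Fin 14)
searchOrder = # 1 ∷ # 8 ∷ # 4 ∷ # 11 ∷ # 10 ∷ # 3 ∷ # 2 ∷ # 13 ∷ # 6 ∷ # 9 ∷ # 5 ∷ # 12 ∷ []

normalisedStart : List (Fin 14 × Subset 6)
normalisedStart = (# 7 , pair (# 2) (# 3)) ∷ (# 0 , pair (# 0) (# 1)) ∷ []

search-fails : extendable requirementᴴ (ofSize 6 2) normalisedStart searchOrder ≡ false
search-fails = refl

no-normalised-colouring : ¬ NormalisedColouring
no-normalised-colouring (g , colouring , g₀ , g₇) = true≢false (begin
  true                                                             ≡⟨ search-succeeds ⟨
  extendable requirementᴴ (ofSize 6 2) normalisedStart searchOrder ≡⟨ search-fails ⟩
  false                                                            ∎)
  where
  open ≡-Reasoning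

  true≢false : true ≢ false
  true≢false ()

  search-succeeds : extendable requirementᴴ (ofSize 6 2) normalisedStart searchOrder ≡ true
  search-succeeds = extendable-sound requirementᴴ (ofSize 6 2) g (colour∈ofSize {f = g} colouring)
                      (heawood-requirements {f = g} colouring) searchOrder normalisedStart (sym g₇ ∷ sym g₀ ∷ [])

mainTheorem5 : ¬ Has2ToneColoring HeawoodAdj 6
mainTheorem5 (f , colouring) = no-normalised-colouring (normalised-colouring {f} colouring)
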